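{- Let $q$ be an odd prime power and $\chi_1$ the coloring defined below on $V=(\mathbb{F}_q^*)^3$. Let $a\in V$ and let $A=(T,\alpha,i)$ be a color, and let $N_A(a)=\{x\in V:\chi_1(a,x)=A\}$. If one of the following holds: (1) $T\in\{\mathrm{ZERO},\mathrm{UP}_2,\mathrm{DOWN}_2\}$; (2) $T=\mathrm{UP}_1$ and $a_1<\alpha-a_1$; (3) $T=\mathrm{DOWN}_1$ and $a_1>\alpha-a_1$, then all vectors of $N_A(a)$ belong to a single one-dimensional affine subspace of $\mathbb{F}_q^3$.
   Context: $q$ is an odd prime power, $\mathbb{F}_q^*$ the nonzero elements of $\mathbb{F}_q$, and $V=(\mathbb{F}_q^*)^3$. For $x,y\in\mathbb{F}_q^3$, $x\cdot y=x_1y_1+x_2y_2+x_3y_3$. Fix an arbitrary linear order $<$ on $\mathbb{F}_q$ and extend it lexicographically to vectors: $x<y$ iff $x_i<y_i$ at the first position $i$ where $x_i\neq y_i$. For distinct $x,y\in V$ define $T(x,y)$ to be: $\mathrm{UP}_1$ if $x\cdot y=x\cdot x$ and $x_1<y_1$; $\mathrm{UP}_2$ if $x\cdot y=x\cdot x$, $x_1=y_1$ and $x<y$; $\mathrm{DOWN}_1$ if $x\cdot y\ne x\cdot x$, $x\cdot y=y\cdot y$ and $x_1<y_1$; $\mathrm{DOWN}_2$ if $x\cdot y\neq x\cdot x$, $x\cdot y=y\cdot y$, $x_1=y_1$ and $x<y$; $\mathrm{ZERO}$ if $x\cdot y\notin\{x\cdot x,y\cdot y\}$ and $x\cdot y=0$;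 $\mathrm{DOT}$ otherwise. Let $f_T(x,y)=x_1+y_1$ if $T\in\{\mathrm{UP}_1,\mathrm{DOWN}_1,\mathrm{ZERO}\}$, $f_T(x,y)=x_2+y_2$ if $T\in\{\mathrm{UP}_2,\mathrm{DOWN}_2\}$, and $f_T(x,y)=x\cdot y$ if $T=\mathrm{DOT}$. Let $\delta(x,y)=0$ if $\{x,y\}$ is linearly dependent and $1$ otherwise. For $x<y$ set $\chi_1(x,y)=(T,f_T(x,y),\delta(x,y))$ with $T=T(x,y)$; this is the color of the edge $\{x,y\}$, so $\chi_1(y,x)=\chi_1(x,y)$. -}

module Defs where

open import Level using (0ℓ)
open import Data.Nat as ℕ using (ℕ; _%_; _^_)
open import Data.Nat.Primality using (Prime)
open import Data.Fin using (Fin)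
import Data.Fin.Properties as FinP
open import Data.Product using (Σ; ∃; ∃-syntax; _×_; _,_; proj₁; proj₂)
open import Data.Sum using (_⊎_; inj₁; inj₂)
open import Data.Bool using (Bool; true; false; if_then_else_)
open import Relation.Nullary using (¬_; Dec; yes; no; does)
open import Relation.Nullary.Decidable using (_×-dec_; _⊎-dec_; ¬?)
open import Relation.Binary.PropositionalEquality
  using (_≡_; _≢_; refl; sym; subst)
open import Relation.Binary.Definitions using (DecidableEquality)
open import Relation.Binary.Core using (Rel)
open import Relation.Binary.Structures using (IsStrictTotalOrder)
open import Algebra.Core using (Op₁; Op₂)
open import Algebra.Structures using (IsCommutativeRing)
open import Function.Bundles using (_↔_; Inverse)

record OddFiniteField : Set₁ where
  infixl 6 _+_
  infixl 7 _*_
  infix 4 _≟_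
  field
    Carrier  : Set
    _+_ _*_  : Op₂ Carrier
    -_       : Op₁ Carrier
    0# 1#    : Carrier
    isCommutativeRing : IsCommutativeRing _≡_ _+_ _*_ -_ 0# 1#
    0≢1      : 0# ≢ 1#
    inverse  : ∀ x → x ≢ 0# → ∃[ y ] (x * y ≡ 1#)
    _≟_      : DecidableEquality Carrier
    q        : ℕ
    enum     : Carrier ↔ Fin q
    q-primePower : ∃[ p ] ∃[ k ] (Prime p × q ≡ p ^ k)
    q-odd    : q % 2 ≡ 1

module Colouring (F : OddFiniteField)
                 (_<_ : Rel (OddFiniteField.Carrier F) 0ℓ)
                 (<-sto : IsStrictTotalOrder _≡_ _<_) where

  open OddFiniteField F

  record Vec3 : Set where
    constructor ⟨_,_,_⟩
    field
      c₁ c₂ c₃ : Carrier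
  open Vec3 public

  InV : Vec3 → Set
  InV x = (c₁ x ≢ 0#) × (c₂ x ≢ 0#) × (c₃ x ≢ 0#)

  infixl 7 _·_
  infixl 6 _+ᵥ_
  infixr 7 _•_
  infix 4 _<ᵥ_ _<?_ _<ᵥ?_
  _·_ : Vec3 → Vec3 → Carrier
  x · y = c₁ x * c₁ y + c₂ x * c₂ y + c₃ x * c₃ y

  _+ᵥ_ : Vec3 → Vec3 → Vec3
  x +ᵥ y = ⟨ c₁ x + c₁ y , c₂ x + c₂ y , c₃ x + c₃ y ⟩

  _•_ : Carrier → Vec3 → Vec3
  t • x = ⟨ t * c₁ x , t * c₂ x , t * c₃ x ⟩

  0ᵥ : Vec3
  0ᵥ = ⟨ 0# , 0# , 0# ⟩

  _<ᵥ_ : Vec3 → Vec3 → Set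
  x <ᵥ y = (c₁ x < c₁ y)
         ⊎ ((c₁ x ≡ c₁ y) × ((c₂ x < c₂ y) ⊎ ((c₂ x ≡ c₂ y) × (c₃ x < c₃ y))))

  _<?_ : ∀ a b → Dec (a < b)
  _<?_ = IsStrictTotalOrder._<?_ <-sto

  _<ᵥ?_ : ∀ x y → Dec (x <ᵥ y)
  x <ᵥ? y = (c₁ x <? c₁ y) ⊎-dec ((c₁ x ≟ c₁ y) ×-dec
              ((c₂ x <? c₂ y) ⊎-dec ((c₂ x ≟ c₂ y) ×-dec (c₃ x <? c₃ y))))

  LinDep : Vec3 → Vec3 → Set
  LinDep x y = ∃[ c ] ∃[ d ] (¬ (c ≡ 0# × d ≡ 0#) × (c • x) +ᵥ (d • y) ≡ 0ᵥ)

  private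
    module E = Inverse enum

    ∃? : {P : Carrier → Set} → (∀ c → Dec (P c)) → Dec (∃ P)
    ∃? {P} P? with FinP.any? (λ i → P? (E.from i))
    ... | yes (i , p) = yes (E.from i , p)
    ... | no ¬p = no λ { (c , p) → ¬p (E.to c , subst P (sym (E.strictlyInverseʳ c)) p) }

    _≟ᵥ_ : DecidableEquality Vec3
    ⟨ a , b , c ⟩ ≟ᵥ ⟨ a' , b' , c' ⟩ with a ≟ a' | b ≟ b' | c ≟ c'
    ... | yes refl | yes refl | yes refl = yes refl
    ... | no ne | _ | _ = no λ { refl → ne refl }
    ... | yes _ | no ne | _ = no λ { refl → ne refl }
    ... | yes _ | yes _ | no ne = no λ { refl → ne refl }

  LinDep? : ∀ x y → Dec (LinDep x y)
  LinDep? x y = ∃? λ c → ∃? λ d →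
    ¬? ((c ≟ 0#) ×-dec (d ≟ 0#)) ×-dec (((c • x) +ᵥ (d • y)) ≟ᵥ 0ᵥ)

  data EdgeType : Set where
    UP₁ UP₂ DOWN₁ DOWN₂ ZERO DOT : EdgeType

  T : Vec3 → Vec3 → EdgeType
  T x y =
    if does ((x · y ≟ x · x) ×-dec (c₁ x <? c₁ y)) then UP₁ else
    if does ((x · y ≟ x · x) ×-dec ((c₁ x ≟ c₁ y) ×-dec (x <ᵥ? y))) then UP₂ else
    if does (¬? (x · y ≟ x · x) ×-dec ((x · y ≟ y · y) ×-dec (c₁ x <? c₁ y))) then DOWN₁ else
    if does (¬? (x · y ≟ x · x) ×-dec ((x · y ≟ y · y) ×-dec
              ((c₁ x ≟ c₁ y) ×-dec (x <ᵥ? y)))) then DOWN₂ else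
    if does (¬? (x · y ≟ x · x) ×-dec (¬? (x · y ≟ y · y) ×-dec (x · y ≟ 0#))) then ZERO else
    DOT

  f : EdgeType → Vec3 → Vec3 → Carrier
  f UP₁   x y = c₁ x + c₁ y
  f DOWN₁ x y = c₁ x + c₁ y
  f ZERO  x y = c₁ x + c₁ y
  f UP₂   x y = c₂ x + c₂ y
  f DOWN₂ x y = c₂ x + c₂ y
  f DOT   x y = x · y

  δ : Vec3 → Vec3 → ℕ
  δ x y = if does (LinDep? x y) then 0 else 1

  Colour : Set
  Colour = EdgeType × Carrier × ℕ

  -- colour of the ordered pair (x, y) with x < y
  χ₁< : Vec3 → Vec3 → Colour
  χ₁< x y = T x y , f (T x y) x y , δ x y

  χ₁ : Vec3 → Vec3 → Colour
  χ₁ x y = if does (x <ᵥ? y) then χ₁< x y else χ₁< y x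

  InN : Colour → Vec3 → Vec3 → Set
  InN A a x = InV x × x ≢ a × χ₁ a x ≡ A

  Hyp : Vec3 → Colour → Set
  Hyp a (t , α , i) =
      (t ≡ ZERO ⊎ t ≡ UP₂ ⊎ t ≡ DOWN₂)
    ⊎ (t ≡ UP₁ × c₁ a < (α + - c₁ a))
    ⊎ (t ≡ DOWN₁ × (α + - c₁ a) < c₁ a)

  InAffineLine : (Vec3 → Set) → Set
  InAffineLine S = ∃[ p ] ∃[ d ] (d ≢ 0ᵥ × (∀ x → S x → ∃[ t ] (x ≡ p +ᵥ (t • d))))

-- Every x ∈ N_A(a) satisfies two affine equations read off from the colour:
-- x₁ = a₁ and x₂ = α − a₂ for UP₂ and DOWN₂, and x₁ = α − a₁ together with
-- a·x = 0 (ZERO) or a·x = a·a (UP₁, DOWN₁). For UP₁ and DOWN₁ the other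
-- orientation of the edge, which would give x·a = x·x instead, puts
-- x₁ = α − a₁ on the side of a₁ excluded by the hypothesis. As a₂ ≠ 0, the two
-- equations are independent, so their common solutions form a line.
module Submission where

open import Defs
open import Level using (0ℓ)
open import Data.Nat using (ℕ)
open import Data.Bool using (if_then_else_)
open import Data.Product using (_,_; _×_)
open import Data.Sum using (_⊎_; inj₁; inj₂)
open import Data.Empty using (⊥-elim)
open import Relation.Nullary using (Dec; does; yes; no)
open import Relation.Nullary.Decidable using (_×-dec_; ¬?)
open import Relation.Binary.Core using (Rel)
open import Relation.Binary.Structures using (IsStrictTotalOrder)
open import Relation.Binary.PropositionalEquality
  using (_≡_; _≢_; refl; sym; trans; cong; cong₂; subst; module ≡-Reasoning)
open import Algebra.Bundles using (CommutativeRing)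
open import Algebra.Structures using (IsCommutativeRing)

if-does-elim : {P : Set} {A : Set} (Q : A → Set) (d : Dec P) {u v : A} →
               (P → Q u) → Q v → Q (if does d then u else v)
if-does-elim Q (yes p) Qu _  = Qu p
if-does-elim Q (no _)  _  Qv = Qv

module Neighbourhoods (F : OddFiniteField)
                      (_<_ : Rel (OddFiniteField.Carrier F) 0ℓ)
                      (<-sto : IsStrictTotalOrder _≡_ _<_) where

  open OddFiniteField F
  open Colouring F _<_ <-sto
  open IsCommutativeRing isCommutativeRing
    using (+-comm; +-identityˡ; +-identityʳ; -‿inverseʳ; *-identityʳ; zeroˡ; zeroʳ)
  open IsStrictTotalOrder <-sto using (asym)
  open ≡-Reasoning

  private
    ring : CommutativeRing 0ℓ 0ℓ
    ring = record { isCommutativeRing = isCommutativeRing }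

  open CommutativeRing ring using (+-group; commutativeSemiring)
  open import Algebra.Properties.Group +-group using (\\-leftDividesʳ)
  open import Algebra.Properties.Ring (CommutativeRing.ring ring) using (-‿distribʳ-*)
  open import Algebra.Solver.Ring.NaturalCoefficients.Default commutativeSemiring
    using (solve; _:=_; _:+_; _:*_)

  variable
    a x y : Vec3
    t : EdgeType
    α β γ s : Carrier
    i : ℕ

  x+y≡z⇒y≡z-x : ∀ {x y z} → x + y ≡ z → y ≡ z + - x
  x+y≡z⇒y≡z-x {x} {y} refl = trans (sym (\\-leftDividesʳ x y)) (+-comm (- x) (x + y))

  x≡x+y*0 : ∀ x y → x ≡ x + y * 0#
  x≡x+y*0 x y = sym (trans (cong (x +_) (zeroʳ y)) (+-identityʳ x))

  ·-comm : ∀ x y → x · y ≡ y · x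
  ·-comm ⟨ x₁ , x₂ , x₃ ⟩ ⟨ y₁ , y₂ , y₃ ⟩ =
    solve 6 (λ x₁ x₂ x₃ y₁ y₂ y₃ →
               x₁ :* y₁ :+ x₂ :* y₂ :+ x₃ :* y₃ := y₁ :* x₁ :+ y₂ :* x₂ :+ y₃ :* x₃)
            refl x₁ x₂ x₃ y₁ y₂ y₃

  c₂-on-plane : ∀ x → c₂ a * s ≡ 1# → c₁ x ≡ β → a · x ≡ γ →
                c₂ x ≡ (γ + - (c₁ a * β)) * s + c₃ x * - (c₃ a * s)
  c₂-on-plane {a = ⟨ a₁ , a₂ , a₃ ⟩} {s = s} ⟨ x₁ , x₂ , x₃ ⟩ a₂s≡1 refl refl = sym (begin
    (u + a₂ * x₂ + a₃ * x₃ + - u) * s + x₃ * - (a₃ * s)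
      ≡⟨ cong ((u + a₂ * x₂ + a₃ * x₃ + - u) * s +_) (sym (-‿distribʳ-* x₃ (a₃ * s))) ⟩
    (u + a₂ * x₂ + a₃ * x₃ + - u) * s + - w
      ≡⟨ solve 8 (λ a₂ a₃ x₂ x₃ s u -u -w →
                    (u :+ a₂ :* x₂ :+ a₃ :* x₃ :+ -u) :* s :+ -w
                    := x₂ :* (a₂ :* s) :+ (u :+ -u) :* s :+ (x₃ :* (a₃ :* s) :+ -w))
                 refl a₂ a₃ x₂ x₃ s u (- u) (- w) ⟩
    x₂ * (a₂ * s) + (u + - u) * s + (w + - w)
      ≡⟨ cong₂ (λ p q → x₂ * (a₂ * s) + p * s + q) (-‿inverseʳ u) (-‿inverseʳ w) ⟩
    x₂ * (a₂ * s) + 0# * s + 0#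
      ≡⟨ trans (+-identityʳ _) (trans (cong (x₂ * (a₂ * s) +_) (zeroˡ s)) (+-identityʳ _)) ⟩
    x₂ * (a₂ * s)
      ≡⟨ cong (x₂ *_) a₂s≡1 ⟩
    x₂ * 1#
      ≡⟨ *-identityʳ x₂ ⟩
    x₂ ∎)
    where
    u = a₁ * x₁
    w = x₃ * (a₃ * s)

  ⟨⟩-cong : ∀ {u₁ u₂ u₃ v₁ v₂ v₃} → u₁ ≡ v₁ → u₂ ≡ v₂ → u₃ ≡ v₃ →
            ⟨ u₁ , u₂ , u₃ ⟩ ≡ ⟨ v₁ , v₂ , v₃ ⟩
  ⟨⟩-cong refl refl refl = refl

  InAffineLine-⊆ : {S S′ : Vec3 → Set} → (∀ x → S x → S′ x) →
                   InAffineLine S′ → InAffineLine S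
  InAffineLine-⊆ S⊆S′ (p , d , d≢0 , on-line) = p , d , d≢0 , λ x x∈S → on-line x (S⊆S′ x x∈S)

  graph-over-c₃-line : ∀ β u w → InAffineLine (λ x → c₁ x ≡ β × c₂ x ≡ u + c₃ x * w)
  graph-over-c₃-line β u w =
    ⟨ β , u , 0# ⟩ , ⟨ 0# , w , 1# ⟩ , (λ d≡0 → 0≢1 (sym (cong c₃ d≡0))) ,
    λ x (x₁≡β , x₂≡u+x₃w) → c₃ x ,
      ⟨⟩-cong (trans x₁≡β (x≡x+y*0 β (c₃ x))) x₂≡u+x₃w
              (sym (trans (+-identityˡ _) (*-identityʳ (c₃ x))))

  level-line : ∀ β u → InAffineLine (λ x → c₁ x ≡ β × c₂ x ≡ u)
  level-line β u = InAffineLine-⊆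
    (λ x (x₁≡β , x₂≡u) → x₁≡β , trans x₂≡u (x≡x+y*0 u (c₃ x)))
    (graph-over-c₃-line β u 0#)

  plane-line : c₂ a ≢ 0# → ∀ β γ → InAffineLine (λ x → c₁ x ≡ β × a · x ≡ γ)
  plane-line {a = a} a₂≢0 β γ with inverse (c₂ a) a₂≢0
  ... | s , a₂s≡1 = InAffineLine-⊆
    (λ x (x₁≡β , a·x≡γ) → x₁≡β , c₂-on-plane x a₂s≡1 x₁≡β a·x≡γ)
    (graph-over-c₃-line β ((γ + - (c₁ a * β)) * s) (- (c₃ a * s)))

  data TSpec (x y : Vec3) : EdgeType → Set where
    up₁   : x · y ≡ x · x → c₁ x < c₁ y → TSpec x y UP₁
    up₂   : x · y ≡ x · x → c₁ x ≡ c₁ y → TSpec x y UP₂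
    down₁ : x · y ≡ y · y → c₁ x < c₁ y → TSpec x y DOWN₁
    down₂ : x · y ≡ y · y → c₁ x ≡ c₁ y → TSpec x y DOWN₂
    zero  : x · y ≡ 0# → TSpec x y ZERO
    dot   : TSpec x y DOT

  T-spec : ∀ x y → TSpec x y (T x y)
  T-spec x y =
    case (x · y ≟ x · x) ×-dec (c₁ x <? c₁ y)
      ⇒ (λ (up , lt) → up₁ up lt)
    else case (x · y ≟ x · x) ×-dec ((c₁ x ≟ c₁ y) ×-dec (x <ᵥ? y))
      ⇒ (λ (up , eq , _) → up₂ up eq)
    else case ¬? (x · y ≟ x · x) ×-dec ((x · y ≟ y · y) ×-dec (c₁ x <? c₁ y))
      ⇒ (λ (_ , down , lt) → down₁ down lt)
    else case ¬? (x · y ≟ x · x) ×-dec ((x · y ≟ y · y) ×-dec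
                ((c₁ x ≟ c₁ y) ×-dec (x <ᵥ? y)))
      ⇒ (λ (_ , down , eq , _) → down₂ down eq)
    else case ¬? (x · y ≟ x · x) ×-dec (¬? (x · y ≟ y · y) ×-dec (x · y ≟ 0#))
      ⇒ (λ (_ , _ , orth) → zero orth)
    else dot
    where
    case_⇒_else_ : ∀ {P : Set} (d : Dec P) {u v} →
                   (P → TSpec x y u) → TSpec x y v → TSpec x y (if does d then u else v)
    case_⇒_else_ = if-does-elim (TSpec x y)

  f-comm : ∀ t x y → f t x y ≡ f t y x
  f-comm UP₁   x y = +-comm (c₁ x) (c₁ y)
  f-comm UP₂   x y = +-comm (c₂ x) (c₂ y)
  f-comm DOWN₁ x y = +-comm (c₁ x) (c₁ y)
  f-comm DOWN₂ x y = +-comm (c₂ x) (c₂ y)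
  f-comm ZERO  x y = +-comm (c₁ x) (c₁ y)
  f-comm DOT   x y = ·-comm x y

  χ₁<-inv : χ₁< x y ≡ (t , α , i) → TSpec x y t × f t x y ≡ α
  χ₁<-inv {x = x} {y = y} refl = T-spec x y , refl

  χ₁-orientations : ∀ {A} → χ₁ x y ≡ A → χ₁< x y ≡ A ⊎ χ₁< y x ≡ A
  χ₁-orientations {x = x} {y = y} {A = A} =
    if-does-elim (λ C → C ≡ A → χ₁< x y ≡ A ⊎ χ₁< y x ≡ A) (x <ᵥ? y) (λ _ → inj₁) inj₂

  χ₁-inv : χ₁ x y ≡ (t , α , i) → (TSpec x y t ⊎ TSpec y x t) × f t x y ≡ α
  χ₁-inv {x = x} {y = y} {t = t} e with χ₁-orientations e
  ... | inj₁ e′ = let spec , fxy≡α = χ₁<-inv e′ in inj₁ spec , fxy≡α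
  ... | inj₂ e′ = let spec , fyx≡α = χ₁<-inv e′ in inj₂ spec , trans (f-comm t x y) fyx≡α

  ZERO-neighbour : χ₁ a x ≡ (ZERO , α , i) → c₁ x ≡ α + - c₁ a × a · x ≡ 0#
  ZERO-neighbour {a = a} {x = x} e with χ₁-inv e
  ... | inj₁ (zero a·x≡0) , sum = x+y≡z⇒y≡z-x sum , a·x≡0
  ... | inj₂ (zero x·a≡0) , sum = x+y≡z⇒y≡z-x sum , trans (·-comm a x) x·a≡0

  UP₁-neighbour : c₁ a < (α + - c₁ a) → χ₁ a x ≡ (UP₁ , α , i) →
                  c₁ x ≡ α + - c₁ a × a · x ≡ a · a
  UP₁-neighbour {a = a} a₁<α-a₁ e with χ₁-inv e
  ... | inj₁ (up₁ a·x≡a·a _) , sum = x+y≡z⇒y≡z-x sum , a·x≡a·a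
  ... | inj₂ (up₁ _ x₁<a₁) , sum =
    ⊥-elim (asym a₁<α-a₁ (subst (_< c₁ a) (x+y≡z⇒y≡z-x sum) x₁<a₁))

  DOWN₁-neighbour : (α + - c₁ a) < c₁ a → χ₁ a x ≡ (DOWN₁ , α , i) →
                    c₁ x ≡ α + - c₁ a × a · x ≡ a · a
  DOWN₁-neighbour {a = a} {x = x} α-a₁<a₁ e with χ₁-inv e
  ... | inj₁ (down₁ _ a₁<x₁) , sum =
    ⊥-elim (asym α-a₁<a₁ (subst (c₁ a <_) (x+y≡z⇒y≡z-x sum) a₁<x₁))
  ... | inj₂ (down₁ x·a≡a·a _) , sum = x+y≡z⇒y≡z-x sum , trans (·-comm a x) x·a≡a·a

  level-neighbour : t ≡ UP₂ ⊎ t ≡ DOWN₂ → χ₁ a x ≡ (t , α , i) →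
                    c₁ x ≡ c₁ a × c₂ x ≡ α + - c₂ a
  level-neighbour (inj₁ refl) e with χ₁-inv e
  ... | inj₁ (up₂ _ a₁≡x₁) , sum = sym a₁≡x₁ , x+y≡z⇒y≡z-x sum
  ... | inj₂ (up₂ _ x₁≡a₁) , sum = x₁≡a₁ , x+y≡z⇒y≡z-x sum
  level-neighbour (inj₂ refl) e with χ₁-inv e
  ... | inj₁ (down₂ _ a₁≡x₁) , sum = sym a₁≡x₁ , x+y≡z⇒y≡z-x sum
  ... | inj₂ (down₂ _ x₁≡a₁) , sum = x₁≡a₁ , x+y≡z⇒y≡z-x sum

  InN-in-line : c₂ a ≢ 0# → ∀ A → Hyp a A → InAffineLine (InN A a)
  InN-in-line a₂≢0 (t , α , i) (inj₁ (inj₁ refl)) =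
    InAffineLine-⊆ (λ x (_ , _ , e) → ZERO-neighbour e) (plane-line a₂≢0 _ _)
  InN-in-line a₂≢0 (t , α , i) (inj₁ (inj₂ level)) =
    InAffineLine-⊆ (λ x (_ , _ , e) → level-neighbour level e) (level-line _ _)
  InN-in-line a₂≢0 (t , α , i) (inj₂ (inj₁ (refl , a₁<α-a₁))) =
    InAffineLine-⊆ (λ x (_ , _ , e) → UP₁-neighbour a₁<α-a₁ e) (plane-line a₂≢0 _ _)
  InN-in-line a₂≢0 (t , α , i) (inj₂ (inj₂ (refl , α-a₁<a₁))) =
    InAffineLine-⊆ (λ x (_ , _ , e) → DOWN₁-neighbour α-a₁<a₁ e) (plane-line a₂≢0 _ _)

mainTheorem10 : (F : OddFiniteField)
    → (_<_ : Rel (OddFiniteField.Carrier F) 0ℓ)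
    → (<-sto : IsStrictTotalOrder _≡_ _<_)
    → (a : Colouring.Vec3 F _<_ <-sto)
    → Colouring.InV F _<_ <-sto a
    → (A : Colouring.Colour F _<_ <-sto)
    → Colouring.Hyp F _<_ <-sto a A
    → Colouring.InAffineLine F _<_ <-sto (Colouring.InN F _<_ <-sto A a)
mainTheorem10 F _<_ <-sto a (_ , a₂≢0 , _) =
  Neighbourhoods.InN-in-line F _<_ <-sto a₂≢0
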